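{- Let $\mathcal{C} = (E, \mathcal{A}, \pi, \mathit{ok}, \vdash, \Vdash)$ be a contract and let $C = \bigcup \{ e \in E : e \text{ is reachable}\}$ be the set of all reachable events. Then $C$ is a configuration of $\mathcal{C}$, and every configuration $C'$ of $\mathcal{C}$ satisfies $C' \subseteq C$.
   Context: A contract is a 6-tuple $\mathcal{C} = (E, \mathcal{A}, \pi, \mathit{ok}, \vdash, \Vdash)$ where $E$ is a finite set of events, $\mathcal{A}$ is a finite set of participants, $\pi : E \to \mathcal{A}$, $\mathit{ok} \subseteq \mathcal{A} \times \mathcal{P}(E)$ satisfies $\mathit{ok}(A,X) \wedge X \subseteq Y \Rightarrow \mathit{ok}(A,Y)$, and $\vdash, \Vdash \subseteq \mathcal{P}(E) \times E$ are saturated: $X \circ e$ and $X \subseteq Y$ imply $Y \circ e$ for $\circ \in \{\vdash, \Vdash\}$. A set $C \subseteq E$ is a configuration of $\mathcal{C}$ iff there exist $e_0, \ldots, e_n$ with $\{e_0,\ldots,e_n\} = C$ such that for every $i \le n$, either $\{e_0,\ldots,e_{i-1}\} \vdash e_i$ or $C \Vdash e_i$. An event is reachable if it belongs to some configuration of $\mathcal{C}$. -}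

module Defs where

open import Level using (Level; _⊔_) renaming (suc to lsuc)
open import Data.Nat using (ℕ)
open import Data.Fin using (Fin)
open import Data.Fin.Subset using (Subset; _⊆_; _∈_; _∪_; ⁅_⁆; ⊥)
open import Data.List using (List; []; _∷_; foldr)
open import Data.List.Relation.Unary.All using (All)
open import Data.Product using (Σ; _×_; ∃)
open import Data.Sum using (_⊎_)
open import Relation.Binary.PropositionalEquality using (_≡_)
open import Data.Unit using (⊤)

-- A contract with events E = Fin n and participants 𝒜 = Fin m.
record Contract (n m : ℕ) : Set₁ where
  field
    π    : Fin n → Fin m
    ok   : Fin m → Subset n → Set
    ⊢    : Subset n → Fin n → Set
    ⊩    : Subset n → Fin n → Set
    ok-mono : ∀ {A X Y} → ok A X → X ⊆ Y → ok A Y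
    ⊢-sat   : ∀ {X Y e} → ⊢ X e → X ⊆ Y → ⊢ Y e
    ⊩-sat   : ∀ {X Y e} → ⊩ X e → X ⊆ Y → ⊩ Y e

setOf : ∀ {n} → List (Fin n) → Subset n
setOf = foldr (λ e X → ⁅ e ⁆ ∪ X) ⊥

module _ {n m : ℕ} (𝒞 : Contract n m) where
  open Contract 𝒞

  -- Every event of the sequence (read left to right, so `past` is the set of
  -- previously listed events) satisfies: past ⊢ eᵢ or C ⊩ eᵢ.
  ValidSeq : Subset n → Subset n → List (Fin n) → Set
  ValidSeq C past []       = ⊤
  ValidSeq C past (e ∷ es) = (⊢ past e ⊎ ⊩ C e) × ValidSeq C (past ∪ ⁅ e ⁆) es

  IsConfiguration : Subset n → Set
  IsConfiguration C = Σ (List (Fin n)) λ es → (setOf es ≡ C) × ValidSeq C ⊥ es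

  Reachable : Fin n → Set
  Reachable e = Σ (Subset n) λ C → IsConfiguration C × e ∈ C

module Submission where

-- Every configuration consists of reachable events, so every
-- configuration is contained in the set C of reachable events; this is the
-- maximality half of the theorem.  For the other half we show that
-- configurations are closed under binary union: if the sequences xs and ys
-- witness C₁ and C₂, then xs ++ ys witnesses C₁ ∪ C₂, because both
-- enabling relations are saturated (a larger past or a larger target set
-- keeps every step enabled).  Starting from the empty configuration and
-- adding, for every event e ∈ C, a configuration containing e, we obtain a
-- configuration D with C ⊆ D.  By maximality D ⊆ C, hence D = C.

open import Defs
open import Data.Nat using (ℕ)
open import Data.Fin using (Fin)
open import Data.Fin.Subset using (Subset; _⊆_; _∈_; _∪_; ⁅_⁆; ⊥)
open import Data.Fin.Subset.Properties
  using (x∈p∪q⁻; x∈p∪q⁺; p⊆p∪q; q⊆p∪q; ⊥⊆; ⊆-antisym; _∈?_; ∪-assoc; ∪-identityˡ)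
open import Data.Product using (Σ; _×_; _,_)
open import Data.Sum using (inj₁; inj₂)
open import Data.List using (List; []; _∷_; _++_; allFin)
open import Data.List.Membership.Propositional.Properties using (∈-allFin)
open import Data.List.Relation.Unary.Any using (here; there)
import Data.List.Membership.Propositional as List
open import Relation.Nullary using (yes; no)
open import Relation.Nullary.Negation using (contradiction)
open import Relation.Binary.PropositionalEquality using (_≡_; refl; sym; cong; subst; module ≡-Reasoning)
open import Data.Unit using (tt)

∪-monoˡ-⊆ : ∀ {n} {P Q : Subset n} (R : Subset n) → P ⊆ Q → P ∪ R ⊆ Q ∪ R
∪-monoˡ-⊆ {P = P} R P⊆Q x∈P∪R with x∈p∪q⁻ P R x∈P∪R
... | inj₁ x∈P = x∈p∪q⁺ (inj₁ (P⊆Q x∈P))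
... | inj₂ x∈R = x∈p∪q⁺ (inj₂ x∈R)

setOf-++ : ∀ {n} (xs ys : List (Fin n)) → setOf (xs ++ ys) ≡ setOf xs ∪ setOf ys
setOf-++ []       ys = sym (∪-identityˡ (setOf ys))
setOf-++ (x ∷ xs) ys = begin
  ⁅ x ⁆ ∪ setOf (xs ++ ys)             ≡⟨ cong (⁅ x ⁆ ∪_) (setOf-++ xs ys) ⟩
  ⁅ x ⁆ ∪ (setOf xs ∪ setOf ys)        ≡⟨ sym (∪-assoc ⁅ x ⁆ (setOf xs) (setOf ys)) ⟩
  (⁅ x ⁆ ∪ setOf xs) ∪ setOf ys        ∎
  where open ≡-Reasoning

module _ {n m : ℕ} (𝒞 : Contract n m) where
  open Contract 𝒞

  -- Saturation of ⊢ and ⊩ makes validity of a sequence monotone both in the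
  -- target set (used by ⊩) and in the set of already listed events (used by ⊢).
  valid-mono : ∀ {C C′ P P′} es → C ⊆ C′ → P ⊆ P′ →
               ValidSeq 𝒞 C P es → ValidSeq 𝒞 C′ P′ es
  valid-mono []       C⊆C′ P⊆P′ tt             = tt
  valid-mono (e ∷ es) C⊆C′ P⊆P′ (inj₁ P⊢e , v) =
    inj₁ (⊢-sat P⊢e P⊆P′) , valid-mono es C⊆C′ (∪-monoˡ-⊆ ⁅ e ⁆ P⊆P′) v
  valid-mono (e ∷ es) C⊆C′ P⊆P′ (inj₂ C⊩e , v) =
    inj₂ (⊩-sat C⊩e C⊆C′) , valid-mono es C⊆C′ (∪-monoˡ-⊆ ⁅ e ⁆ P⊆P′) v

  valid-++ : ∀ {C P} xs ys → ValidSeq 𝒞 C P xs → ValidSeq 𝒞 C ⊥ ys →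
             ValidSeq 𝒞 C P (xs ++ ys)
  valid-++ []       ys tt       vys = valid-mono ys (λ x∈C → x∈C) ⊥⊆ vys
  valid-++ (x ∷ xs) ys (d , vxs) vys = d , valid-++ xs ys vxs vys

  ⊥-configuration : IsConfiguration 𝒞 ⊥
  ⊥-configuration = [] , refl , tt

  ∪-configuration : ∀ {C₁ C₂} → IsConfiguration 𝒞 C₁ → IsConfiguration 𝒞 C₂ →
                    IsConfiguration 𝒞 (C₁ ∪ C₂)
  ∪-configuration {C₁} {C₂} (xs , refl , vxs) (ys , refl , vys) =
    xs ++ ys , setOf-++ xs ys ,
    valid-++ xs ys (valid-mono xs (p⊆p∪q C₂) (λ x∈⊥ → x∈⊥) vxs)
                   (valid-mono ys (q⊆p∪q C₁ C₂) (λ x∈⊥ → x∈⊥) vys)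

  covering-list : (S : Subset n) → (∀ e → e ∈ S → Reachable 𝒞 e) →
                  (es : List (Fin n)) →
                  Σ (Subset n) λ D → IsConfiguration 𝒞 D ×
                                     (∀ {x} → x List.∈ es → x ∈ S → x ∈ D)
  covering-list S reach []       = ⊥ , ⊥-configuration , λ ()
  covering-list S reach (e ∷ es) with covering-list S reach es | e ∈? S
  ... | D , cfg , covers | no e∉S =
    D , cfg , λ { (here refl) e∈S → contradiction e∈S e∉S
                ; (there x∈es)     → covers x∈es }
  ... | D , cfg , covers | yes e∈S with reach e e∈S
  ...   | Cₑ , cfgₑ , e∈Cₑ =
    Cₑ ∪ D , ∪-configuration cfgₑ cfg ,
    λ { (here refl) _    → p⊆p∪q D e∈Cₑ
      ; (there x∈es) x∈S → q⊆p∪q Cₑ D (covers x∈es x∈S) }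

  covering : (S : Subset n) → (∀ e → e ∈ S → Reachable 𝒞 e) →
             Σ (Subset n) λ D → IsConfiguration 𝒞 D × S ⊆ D
  covering S reach with covering-list S reach (allFin n)
  ... | D , cfg , covers = D , cfg , λ {x} x∈S → covers (∈-allFin x) x∈S

lemma3 : {n m : ℕ} (𝒞 : Contract n m) (C : Subset n) →
    (∀ e → e ∈ C → Reachable 𝒞 e) → (∀ e → Reachable 𝒞 e → e ∈ C) →
    IsConfiguration 𝒞 C × (∀ C′ → IsConfiguration 𝒞 C′ → C′ ⊆ C)
lemma3 𝒞 C reachable all-reachable with covering 𝒞 C reachable
... | D , cfg , C⊆D = subst (IsConfiguration 𝒞) D≡C cfg , maximal
  where
  maximal : ∀ C′ → IsConfiguration 𝒞 C′ → C′ ⊆ C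
  maximal C′ cfg′ {x} x∈C′ = all-reachable x (C′ , cfg′ , x∈C′)

  D≡C : D ≡ C
  D≡C = ⊆-antisym (maximal D cfg) C⊆D
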